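{- Let $n$ and $m$ be odd positive integers, where $n$ has exactly $k$ binary digits and $m$ has exactly $h$ binary digits (i.e. $2^{k-1}\le n<2^k$ and $2^{h-1}\le m<2^h$). If $\nu$ is an integer with $\nu\ge\max\{2h-1,\,h+k+1\}$, then $$B(n2^\nu-m)=B(n)-B(m)+\nu$$ and $$B\big((n2^\nu-m)^2\big)=B(n^2)+B(m^2)-B(mn)+\nu-1,$$ where $B(x)$ denotes the number of ones in the binary expansion of $x$.
   Context: For a positive integer $x$, $B(x)$ denotes the sum of the binary digits of $x$ (its Hamming weight). -}

module Defs where

open import Data.Nat using (ℕ; zero; suc; _+_; _%_; _/_)

-- Sum of binary digits, computed with fuel (fuel ≥ x suffices since x / 2 < x for x > 0).
B-fuel : ℕ → ℕ → ℕ
B-fuel zero x = 0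
B-fuel (suc f) zero = 0
B-fuel (suc f) (suc x) = (suc x) % 2 + B-fuel f ((suc x) / 2)

B : ℕ → ℕ
B x = B-fuel x x

{-# OPTIONS --safe #-}
-- n·2^ν − m = (n − 1)·2^ν + (2^ν − m) with 2^ν − m < 2^ν, so the binary digits of the two
-- blocks simply concatenate; and for odd m, 2^ν − m = (2^ν − 1) − (m − 1) is the ν-bit
-- complement of m − 1, whence B (2^ν − m) = ν + 1 − B m.  For the square,
-- (n·2^ν − m)² = (n²·2^(ν−1) − mn)·2^(ν+1) + m² with m² < 2^(ν+1) and mn ≤ 2^(ν−1), so it
-- splits into two blocks again, and the upper block is the first identity for n², mn, ν − 1.
module Submission where

open import Defs
open import Data.Nat using (ℕ; _+_; _*_; _∸_; _^_; _≤_; _<_; _⊔_; _%_)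
open import Data.Integer as ℤ using (ℤ; +_)
open import Data.Product using (_×_)
open import Relation.Binary.PropositionalEquality using (_≡_)

open import Data.Nat using (zero; suc; _/_; z≤n; s≤s; s≤s⁻¹; z<s)
open import Data.Nat.Properties
open import Data.Nat.DivMod
open import Data.Nat.Divisibility using (divides-refl)
open import Data.Nat.Solver using (module +-*-Solver)
open import Data.Nat.Tactic.RingSolver using (solve-∀)
import Data.Integer.Tactic.RingSolver as ℤ-Solver
open import Data.Product using (_,_)
open import Function using (_∘_)
open import Relation.Nullary using (contradiction)
open import Relation.Binary.PropositionalEquality
  using (refl; sym; trans; cong; cong₂; subst; module ≡-Reasoning)

[1+x]/2≤x : ∀ x → suc x / 2 ≤ x
[1+x]/2≤x x = s≤s⁻¹ (m/n<m (suc x) 2 (s≤s (s≤s z≤n)))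

B-fuel-irrelevant : ∀ {f g} x → x ≤ f → x ≤ g → B-fuel f x ≡ B-fuel g x
B-fuel-irrelevant {zero}  {zero}  zero    _         _         = refl
B-fuel-irrelevant {zero}  {suc _} zero    _         _         = refl
B-fuel-irrelevant {suc _} {zero}  zero    _         _         = refl
B-fuel-irrelevant {suc _} {suc _} zero    _         _         = refl
B-fuel-irrelevant {suc f} {suc g} (suc x) (s≤s x≤f) (s≤s x≤g) =
  cong (_+_ (suc x % 2))
       (B-fuel-irrelevant (suc x / 2) (≤-trans ([1+x]/2≤x x) x≤f) (≤-trans ([1+x]/2≤x x) x≤g))

B-unfold : ∀ x → B x ≡ x % 2 + B (x / 2)
B-unfold zero    = refl
B-unfold (suc x) = cong (_+_ (suc x % 2)) (B-fuel-irrelevant (suc x / 2) ([1+x]/2≤x x) ≤-refl)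

B[r+q*2]≡r+B[q] : ∀ {r} q → r < 2 → B (r + q * 2) ≡ r + B q
B[r+q*2]≡r+B[q] {r} q r<2 = begin
  B (r + q * 2)                          ≡⟨ B-unfold (r + q * 2) ⟩
  (r + q * 2) % 2 + B ((r + q * 2) / 2)  ≡⟨ cong₂ (λ r′ q′ → r′ + B q′) remainder quotient ⟩
  r + B q                                ∎
  where
  open ≡-Reasoning
  remainder : (r + q * 2) % 2 ≡ r
  remainder = trans ([m+kn]%n≡m%n r q 2) (m<n⇒m%n≡m r<2)
  quotient : (r + q * 2) / 2 ≡ q
  quotient = trans (+-distrib-/-∣ʳ r (divides-refl q)) (cong₂ _+_ (m<n⇒m/n≡0 r<2) (m*n/n≡m q 2))

B[1+n]≡1+B[n] : ∀ n → suc n % 2 ≡ 1 → B (suc n) ≡ suc (B n)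
B[1+n]≡1+B[n] n 1+n-odd = begin
  B (suc n)        ≡⟨ cong B 1+n≡1+q*2 ⟩
  B (1 + q * 2)    ≡⟨ B[r+q*2]≡r+B[q] q (s≤s (s≤s z≤n)) ⟩
  suc (B q)        ≡⟨ cong suc (B[r+q*2]≡r+B[q] q z<s) ⟨
  suc (B (q * 2))  ≡⟨ cong (suc ∘ B) (suc-injective 1+n≡1+q*2) ⟨
  suc (B n)        ∎
  where
  open ≡-Reasoning
  q = suc n / 2
  1+n≡1+q*2 : suc n ≡ 1 + q * 2
  1+n≡1+q*2 = trans (m≡m%n+[m/n]*n (suc n) 2) (cong (_+ q * 2) 1+n-odd)

B[a*2^j+b]≡B[a]+B[b] : ∀ j a {b} → b < 2 ^ j → B (a * 2 ^ j + b) ≡ B a + B b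
B[a*2^j+b]≡B[a]+B[b] zero a (s≤s z≤n) =
  trans (cong B (trans (+-identityʳ (a * 1)) (*-identityʳ a))) (sym (+-identityʳ (B a)))
B[a*2^j+b]≡B[a]+B[b] (suc j) a {b} b<2^[1+j] = begin
  B (a * 2 ^ suc j + b)              ≡⟨ cong (λ b′ → B (a * 2 ^ suc j + b′)) (m≡m%n+[m/n]*n b 2) ⟩
  B (a * (2 * 2 ^ j) + (r + q * 2))  ≡⟨ cong B (shuffle a (2 ^ j) r q) ⟩
  B (r + (a * 2 ^ j + q) * 2)        ≡⟨ B[r+q*2]≡r+B[q] (a * 2 ^ j + q) (m%n<n b 2) ⟩
  r + B (a * 2 ^ j + q)              ≡⟨ cong (_+_ r) (B[a*2^j+b]≡B[a]+B[b] j a q<2^j) ⟩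
  r + (B a + B q)                    ≡⟨ exchange r (B a) (B q) ⟩
  B a + (r + B q)                    ≡⟨ cong (_+_ (B a)) (B-unfold b) ⟨
  B a + B b                          ∎
  where
  open ≡-Reasoning
  r = b % 2
  q = b / 2
  q<2^j : q < 2 ^ j
  q<2^j = m<n*o⇒m/o<n (subst (b <_) (*-comm 2 (2 ^ j)) b<2^[1+j])
  shuffle : ∀ a P r q → a * (2 * P) + (r + q * 2) ≡ r + (a * P + q) * 2
  shuffle = solve-∀
  exchange : ∀ x y z → x + (y + z) ≡ y + (x + z)
  exchange = solve-∀

[r+s+1]%2≡0⇒r+s≡1 : ∀ {r s} → r < 2 → s < 2 → (r + s + 1) % 2 ≡ 0 → r + s ≡ 1
[r+s+1]%2≡0⇒r+s≡1 {0}           {0}           _              _              ()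
[r+s+1]%2≡0⇒r+s≡1 {0}           {1}           _              _              _ = refl
[r+s+1]%2≡0⇒r+s≡1 {1}           {0}           _              _              _ = refl
[r+s+1]%2≡0⇒r+s≡1 {1}           {1}           _              _              ()
[r+s+1]%2≡0⇒r+s≡1 {suc (suc _)} {_}           (s≤s (s≤s ())) _              _
[r+s+1]%2≡0⇒r+s≡1 {_}           {suc (suc _)} _              (s≤s (s≤s ())) _

B-complement : ∀ j c d → suc (c + d) ≡ 2 ^ j → B c + B d ≡ j
B-complement zero    zero    zero    _ = refl
B-complement zero    zero    (suc _) ()
B-complement zero    (suc _) _       ()
B-complement (suc j) c d c+d+1≡2^[1+j] = begin
  B c + B d              ≡⟨ cong₂ _+_ (B-unfold c) (B-unfold d) ⟩
  r + B q + (s + B t)    ≡⟨ interchange r (B q) s (B t) ⟩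
  (r + s) + (B q + B t)  ≡⟨ cong₂ _+_ r+s≡1 (B-complement j q t q+t+1≡2^j) ⟩
  1 + j                  ∎
  where
  open ≡-Reasoning
  r = c % 2
  q = c / 2
  s = d % 2
  t = d / 2
  interchange : ∀ w x y z → w + x + (y + z) ≡ (w + y) + (x + z)
  interchange = solve-∀
  regroup : ∀ r q s t → suc (r + q * 2 + (s + t * 2)) ≡ r + s + 1 + (q + t) * 2
  regroup = solve-∀
  digits : suc (c + d) ≡ r + s + 1 + (q + t) * 2
  digits = trans (cong₂ (λ c′ d′ → suc (c′ + d′)) (m≡m%n+[m/n]*n c 2) (m≡m%n+[m/n]*n d 2))
                 (regroup r q s t)
  r+s≡1 : r + s ≡ 1
  r+s≡1 = [r+s+1]%2≡0⇒r+s≡1 (m%n<n c 2) (m%n<n d 2) (begin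
    (r + s + 1) % 2                ≡⟨ [m+kn]%n≡m%n (r + s + 1) (q + t) 2 ⟨
    (r + s + 1 + (q + t) * 2) % 2  ≡⟨ cong (_% 2) (trans (sym digits) c+d+1≡2^[1+j]) ⟩
    (2 * 2 ^ j) % 2                ≡⟨ cong (_% 2) (*-comm 2 (2 ^ j)) ⟩
    (2 ^ j * 2) % 2                ≡⟨ m*n%n≡0 (2 ^ j) 2 ⟩
    0                              ∎)
  q+t+1≡2^j : suc (q + t) ≡ 2 ^ j
  q+t+1≡2^j = *-cancelʳ-≡ _ _ 2 (begin
    suc (q + t) * 2                ≡⟨ cong (λ x → x + 1 + (q + t) * 2) r+s≡1 ⟨
    r + s + 1 + (q + t) * 2        ≡⟨ trans (sym digits) c+d+1≡2^[1+j] ⟩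
    2 * 2 ^ j                      ≡⟨ *-comm 2 (2 ^ j) ⟩
    2 ^ j * 2                      ∎)

B[2^j∸m]+B[m]≡1+j : ∀ j m → m % 2 ≡ 1 → m ≤ 2 ^ j → B (2 ^ j ∸ m) + B m ≡ suc j
B[2^j∸m]+B[m]≡1+j j (suc m) m-odd m≤2^j = begin
  B (2 ^ j ∸ suc m) + B (suc m)  ≡⟨ cong (_+_ (B (2 ^ j ∸ suc m))) (B[1+n]≡1+B[n] m m-odd) ⟩
  B (2 ^ j ∸ suc m) + suc (B m)  ≡⟨ +-suc (B (2 ^ j ∸ suc m)) (B m) ⟩
  suc (B (2 ^ j ∸ suc m) + B m)  ≡⟨ cong suc (B-complement j (2 ^ j ∸ suc m) m complementary) ⟩
  suc j                          ∎
  where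
  open ≡-Reasoning
  complementary : suc (2 ^ j ∸ suc m + m) ≡ 2 ^ j
  complementary = trans (sym (+-suc (2 ^ j ∸ suc m) m)) (m∸n+n≡m m≤2^j)

B[n*2^j∸m]+B[m]≡B[n]+j : ∀ j n m → n % 2 ≡ 1 → m % 2 ≡ 1 → m ≤ 2 ^ j →
                         B (n * 2 ^ j ∸ m) + B m ≡ B n + j
B[n*2^j∸m]+B[m]≡B[n]+j j (suc n) m@(suc _) n-odd m-odd m≤2^j = begin
  B (suc n * 2 ^ j ∸ m) + B m        ≡⟨ cong (λ x → B x + B m) split ⟩
  B (n * 2 ^ j + (2 ^ j ∸ m)) + B m  ≡⟨ cong (_+ B m) (B[a*2^j+b]≡B[a]+B[b] j n 2^j∸m<2^j) ⟩
  B n + B (2 ^ j ∸ m) + B m          ≡⟨ +-assoc (B n) (B (2 ^ j ∸ m)) (B m) ⟩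
  B n + (B (2 ^ j ∸ m) + B m)        ≡⟨ cong (_+_ (B n)) (B[2^j∸m]+B[m]≡1+j j m m-odd m≤2^j) ⟩
  B n + suc j                        ≡⟨ +-suc (B n) j ⟩
  suc (B n) + j                      ≡⟨ cong (_+ j) (B[1+n]≡1+B[n] n n-odd) ⟨
  B (suc n) + j                      ∎
  where
  open ≡-Reasoning
  split : suc n * 2 ^ j ∸ m ≡ n * 2 ^ j + (2 ^ j ∸ m)
  split = trans (cong (_∸ m) (+-comm (2 ^ j) (n * 2 ^ j))) (+-∸-assoc (n * 2 ^ j) m≤2^j)
  2^j∸m<2^j : 2 ^ j ∸ m < 2 ^ j
  2^j∸m<2^j = ∸-monoʳ-< z<s m≤2^j

[n*2Q∸m]^2≡[n^2*Q∸m*n]*4Q+m^2 : ∀ n Q {m} → m ≤ n * Q →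
  (n * (2 * Q) ∸ m) ^ 2 ≡ (n ^ 2 * Q ∸ m * n) * (2 * (2 * Q)) + m ^ 2
[n*2Q∸m]^2≡[n^2*Q∸m*n]*4Q+m^2 n Q {m} m≤nQ = begin
  (n * (2 * Q) ∸ m) ^ 2                        ≡⟨ cong (_^ 2) 2nQ∸m≡m+2D ⟩
  (m + 2 * D) ^ 2                              ≡⟨ square m D ⟩
  2 * (2 * D) * (m + D) + m ^ 2                ≡⟨ cong (λ x → 2 * (2 * D) * x + m ^ 2) m+D≡nQ ⟩
  2 * (2 * D) * (n * Q) + m ^ 2                ≡⟨ cong (_+ m ^ 2) (reorder n Q D) ⟩
  n * D * (2 * (2 * Q)) + m ^ 2                ≡⟨ cong (λ x → x * (2 * (2 * Q)) + m ^ 2) n^2Q∸mn≡nD ⟨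
  (n ^ 2 * Q ∸ m * n) * (2 * (2 * Q)) + m ^ 2  ∎
  where
  open ≡-Reasoning
  open +-*-Solver using (solve; _:=_; _:+_; _:*_; _:^_; con)
  D = n * Q ∸ m
  m+D≡nQ : m + D ≡ n * Q
  m+D≡nQ = m+[n∸m]≡n m≤nQ
  square : ∀ m D → (m + 2 * D) ^ 2 ≡ 2 * (2 * D) * (m + D) + m ^ 2
  square = solve 2 (λ m D → (m :+ con 2 :* D) :^ 2 := con 2 :* (con 2 :* D) :* (m :+ D) :+ m :^ 2) refl
  reorder : ∀ n Q D → 2 * (2 * D) * (n * Q) ≡ n * D * (2 * (2 * Q))
  reorder = solve-∀
  2nQ≡2[nQ] : ∀ n Q → n * (2 * Q) ≡ 2 * (n * Q)
  2nQ≡2[nQ] = solve-∀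
  2[m+D]≡m+[m+2D] : ∀ m D → 2 * (m + D) ≡ m + (m + 2 * D)
  2[m+D]≡m+[m+2D] = solve-∀
  n^2Q≡n[nQ] : ∀ n Q → n ^ 2 * Q ≡ n * (n * Q)
  n^2Q≡n[nQ] = solve 2 (λ n Q → n :^ 2 :* Q := n :* (n :* Q)) refl
  2nQ∸m≡m+2D : n * (2 * Q) ∸ m ≡ m + 2 * D
  2nQ∸m≡m+2D = begin
    n * (2 * Q) ∸ m      ≡⟨ cong (_∸ m) (2nQ≡2[nQ] n Q) ⟩
    2 * (n * Q) ∸ m      ≡⟨ cong (λ x → 2 * x ∸ m) m+D≡nQ ⟨
    2 * (m + D) ∸ m      ≡⟨ cong (_∸ m) (2[m+D]≡m+[m+2D] m D) ⟩
    m + (m + 2 * D) ∸ m  ≡⟨ m+n∸m≡n m (m + 2 * D) ⟩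
    m + 2 * D            ∎
  n^2Q∸mn≡nD : n ^ 2 * Q ∸ m * n ≡ n * D
  n^2Q∸mn≡nD = begin
    n ^ 2 * Q ∸ m * n      ≡⟨ cong₂ _∸_ (n^2Q≡n[nQ] n Q) (*-comm m n) ⟩
    n * (n * Q) ∸ n * m    ≡⟨ *-distribˡ-∸ n (n * Q) m ⟨
    n * D                  ∎

*-pres-odd : ∀ m n → m % 2 ≡ 1 → n % 2 ≡ 1 → m * n % 2 ≡ 1
*-pres-odd m n m-odd n-odd = trans (%-distribˡ-* m n 2) (cong₂ (λ x y → x * y % 2) m-odd n-odd)

^-pres-odd : ∀ n e → n % 2 ≡ 1 → n ^ e % 2 ≡ 1
^-pres-odd n zero    _     = refl
^-pres-odd n (suc e) n-odd = *-pres-odd n (n ^ e) n-odd (^-pres-odd n e n-odd)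

B[[n*2^[1+μ]∸m]^2]+B[m*n]≡B[n^2]+B[m^2]+μ : ∀ μ n m → n % 2 ≡ 1 → m % 2 ≡ 1 →
  m * n ≤ 2 ^ μ → m ^ 2 < 2 ^ (2 + μ) →
  B ((n * 2 ^ (1 + μ) ∸ m) ^ 2) + B (m * n) ≡ B (n ^ 2) + B (m ^ 2) + μ
B[[n*2^[1+μ]∸m]^2]+B[m*n]≡B[n^2]+B[m^2]+μ μ n@(suc _) m n-odd m-odd mn≤2^μ m^2<2^[2+μ] = begin
  B ((n * 2 ^ (1 + μ) ∸ m) ^ 2) + B (m * n)          ≡⟨ cong (λ x → B x + B (m * n)) expand ⟩
  B (upper * 2 ^ (2 + μ) + m ^ 2) + B (m * n)        ≡⟨ cong (_+ B (m * n)) split ⟩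
  B upper + B (m ^ 2) + B (m * n)                    ≡⟨ +-right-comm (B upper) (B (m ^ 2)) (B (m * n)) ⟩
  B upper + B (m * n) + B (m ^ 2)                    ≡⟨ cong (_+ B (m ^ 2)) upper-weight ⟩
  B (n ^ 2) + μ + B (m ^ 2)                          ≡⟨ +-right-comm (B (n ^ 2)) μ (B (m ^ 2)) ⟩
  B (n ^ 2) + B (m ^ 2) + μ                          ∎
  where
  open ≡-Reasoning
  upper : ℕ
  upper = n ^ 2 * 2 ^ μ ∸ m * n
  m≤n*2^μ : m ≤ n * 2 ^ μ
  m≤n*2^μ = ≤-trans (m≤m*n m n) (≤-trans mn≤2^μ (m≤n*m (2 ^ μ) n))
  expand : (n * 2 ^ (1 + μ) ∸ m) ^ 2 ≡ upper * 2 ^ (2 + μ) + m ^ 2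
  expand = [n*2Q∸m]^2≡[n^2*Q∸m*n]*4Q+m^2 n (2 ^ μ) m≤n*2^μ
  split : B (upper * 2 ^ (2 + μ) + m ^ 2) ≡ B upper + B (m ^ 2)
  split = B[a*2^j+b]≡B[a]+B[b] (2 + μ) upper m^2<2^[2+μ]
  upper-weight : B upper + B (m * n) ≡ B (n ^ 2) + μ
  upper-weight = B[n*2^j∸m]+B[m]≡B[n]+j μ (n ^ 2) (m * n)
    (^-pres-odd n 2 n-odd) (*-pres-odd m n m-odd n-odd) mn≤2^μ
  +-right-comm : ∀ x y z → x + y + z ≡ x + z + y
  +-right-comm = solve-∀

m+o≡n+p⇒+m≡+n-+o++p : ∀ {m n o p} → m + o ≡ n + p → + m ≡ + n ℤ.- + o ℤ.+ + p
m+o≡n+p⇒+m≡+n-+o++p {m} {n} {o} {p} m+o≡n+p = begin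
  + m                  ≡⟨ x≡x+y-y (+ m) (+ o) ⟩
  + (m + o) ℤ.- + o    ≡⟨ cong (λ x → + x ℤ.- + o) m+o≡n+p ⟩
  + (n + p) ℤ.- + o    ≡⟨ x+z-y≡x-y+z (+ n) (+ o) (+ p) ⟩
  + n ℤ.- + o ℤ.+ + p  ∎
  where
  open ≡-Reasoning
  x≡x+y-y : ∀ x y → x ≡ x ℤ.+ y ℤ.- y
  x≡x+y-y = ℤ-Solver.solve-∀
  x+z-y≡x-y+z : ∀ x y z → x ℤ.+ z ℤ.- y ≡ x ℤ.- y ℤ.+ z
  x+z-y≡x-y+z = ℤ-Solver.solve-∀

x+m≡x+[1+m]-1 : ∀ x m → x ℤ.+ m ≡ x ℤ.+ (+ 1 ℤ.+ m) ℤ.- + 1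
x+m≡x+[1+m]-1 = ℤ-Solver.solve-∀

lemma3 : (n m k h ν : ℕ) →
    n % 2 ≡ 1 → m % 2 ≡ 1 →
    2 ^ (k ∸ 1) ≤ n → n < 2 ^ k →
    2 ^ (h ∸ 1) ≤ m → m < 2 ^ h →
    ((2 * h ∸ 1) ⊔ (h + k + 1)) ≤ ν →
    (+ B (n * 2 ^ ν ∸ m) ≡ (+ B n ℤ.- + B m) ℤ.+ + ν)
    × (+ B ((n * 2 ^ ν ∸ m) ^ 2) ≡ (((+ B (n ^ 2) ℤ.+ + B (m ^ 2)) ℤ.- + B (m * n)) ℤ.+ + ν) ℤ.- + 1)
lemma3 n m k h zero _ _ _ _ _ _ ν-large =
  contradiction (m+n≤o⇒n≤o (h + k) (m⊔n≤o⇒n≤o (2 * h ∸ 1) (h + k + 1) ν-large)) λ ()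
lemma3 n m k h (suc μ) n-odd m-odd _ n<2^k _ m<2^h ν-large =
  m+o≡n+p⇒+m≡+n-+o++p (B[n*2^j∸m]+B[m]≡B[n]+j (suc μ) n m n-odd m-odd m≤2^ν) ,
  trans (m+o≡n+p⇒+m≡+n-+o++p
          (B[[n*2^[1+μ]∸m]^2]+B[m*n]≡B[n^2]+B[m^2]+μ μ n m n-odd m-odd mn≤2^μ m^2<2^[2+μ]))
        (x+m≡x+[1+m]-1 (+ B (n ^ 2) ℤ.+ + B (m ^ 2) ℤ.- + B (m * n)) (+ μ))
  where
  open ≤-Reasoning
  h+k≤μ : h + k ≤ μ
  h+k≤μ = s≤s⁻¹ (subst (_≤ suc μ) (+-comm (h + k) 1) (m⊔n≤o⇒n≤o (2 * h ∸ 1) (h + k + 1) ν-large))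
  2h≤2+μ : 2 * h ≤ 2 + μ
  2h≤2+μ = ≤-trans (m≤n+m∸n (2 * h) 1) (s≤s (m⊔n≤o⇒m≤o (2 * h ∸ 1) (h + k + 1) ν-large))
  m≤2^ν : m ≤ 2 ^ suc μ
  m≤2^ν = ≤-trans (<⇒≤ m<2^h) (^-monoʳ-≤ 2 (≤-trans (m≤m+n h k) (≤-trans h+k≤μ (n≤1+n μ))))
  mn≤2^μ : m * n ≤ 2 ^ μ
  mn≤2^μ = <⇒≤ (begin-strict
    m * n          <⟨ *-mono-< m<2^h n<2^k ⟩
    2 ^ h * 2 ^ k  ≡⟨ ^-distribˡ-+-* 2 h k ⟨
    2 ^ (h + k)    ≤⟨ ^-monoʳ-≤ 2 h+k≤μ ⟩
    2 ^ μ          ∎)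
  m^2<2^[2+μ] : m ^ 2 < 2 ^ (2 + μ)
  m^2<2^[2+μ] = begin-strict
    m ^ 2          <⟨ ^-monoˡ-< 2 m<2^h ⟩
    (2 ^ h) ^ 2    ≡⟨ ^-*-assoc 2 h 2 ⟩
    2 ^ (h * 2)    ≤⟨ ^-monoʳ-≤ 2 (subst (_≤ 2 + μ) (*-comm 2 h) 2h≤2+μ) ⟩
    2 ^ (2 + μ)    ∎
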